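{- In the satisfaction system of preference statements with hierarchical models, let $\Phi_1,\ldots,\Phi_n\subseteq\mathcal{L}$ be non-trivial sets of statements and let $\alpha,\beta\in\underline{V}$. If the strict statement $\alpha>\beta$ satisfies (P3) and (P4), then the non-strict statement $\alpha\geq\beta$ satisfies (P3) and (P4).
   Context: Let $V$ be a finite set of variables; each $v\in V$ has a finite domain $\underline{v}$ with more than one element; alternatives are elements $\alpha\in\underline{V}=\prod_{v\in V}\underline{v}$, with $\alpha(v)$ the value of $v$. Let $\oplus$ be a commutative, associative operator combining values of any nonempty set of variables, and assume a total order $\geq$ on the domains and on $\oplus$-combinations of values. A hierarchical model is a non-empty sequence $\pi=(Y_1,\ldots,Y_k)$ of non-empty (not necessarily disjoint) subsets of $V$. For alternatives $\alpha,\beta$: $\alpha\succeq_\pi\beta$ iff either $\bigoplus_{y\in Y_i}\alpha(y)=\bigoplus_{y\in Y_i}\beta(y)$ for all $i$, or there is $i$ with $\bigoplus_{y\in Y_i}\alpha(y)>\bigoplus_{y\in Y_i}\beta(y)$ and equality for all $j<i$; $\alpha\succ_\pi\beta$ iff the second condition holds. The language is $\mathcal{L}=\{\alpha\geq\beta\}\cup\{\alpha>\beta\}$ over $\alpha,\beta\in\underline{V}$, with $\pi\models\alpha\geq\beta$ iff $\alpha\succeq_\pi\beta$ and $\pi\models\alpha>\beta$ iff $\alpha\succ_\pi\beta$. For sets: $\pi\models\Phi$ iff $\pi$ satisfies every element; $\Phi\models\Phi'$ iff every model of $\Phi$ is a model of $\Phi'$; consistent = has a model; falsifiable = some hierarchical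 model does not satisfy it; non-trivial = both. A statement $\varphi$ (as $\{\varphi\}$) satisfies (P3) for $\Phi_1,\ldots,\Phi_n$ if for every $i$ and every $\phi_i\in\Phi_i$ some hierarchical model satisfies both $\varphi$ and $\phi_i$; it satisfies (P4) if $\Phi_i\models\varphi$ for some $i$. -}

module Defs where

open import Level using (0ℓ)
open import Data.Nat using (ℕ; suc; _+_)
open import Data.Fin using (Fin; _<_)
open import Data.Fin.Subset using (Subset; Nonempty)
open import Data.Bool using (if_then_else_)
import Data.Vec
open import Data.List using (List; []; _∷_; foldr; length)
open import Data.List.NonEmpty using (List⁺; toList)
open import Data.Maybe using (Maybe; just; nothing)
open import Data.Product using (Σ; ∃; _×_; proj₁)
open import Data.Empty using (⊥)
open import Data.Sum using (_⊎_)
open import Relation.Nullary using (¬_)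
open import Relation.Binary.PropositionalEquality using (_≡_)
open import Relation.Binary.Definitions using (Transitive)
open import Relation.Binary.Structures using (IsStrictTotalOrder)
open import Function.Definitions using (Injective)

-- The fixed ingredients of the satisfaction system.
-- * V = Fin nVars (a finite set of variables).
-- * All values (domain values and ⊕-combinations) live in a carrier A,
--   with a commutative, associative operator _⊕_ and a strict total order _≺_
--   (x ≺ y means y > x); "≥" on A is its reflexive closure.
-- * The domain of variable v has 2 + extra v elements (i.e. more than one),
--   embedded injectively into A by val v.
record Setting : Set₁ where
  field
    nVars    : ℕ
    A        : Set
    _⊕_      : A → A → A
    ⊕-comm   : ∀ x y → x ⊕ y ≡ y ⊕ x
    ⊕-assoc  : ∀ x y z → (x ⊕ y) ⊕ z ≡ x ⊕ (y ⊕ z)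
    _≺_      : A → A → Set
    ≺-sto    : IsStrictTotalOrder _≡_ _≺_
    extra    : Fin nVars → ℕ
    val      : (v : Fin nVars) → Fin (2 + extra v) → A
    val-inj  : ∀ v → Injective _≡_ _≡_ (val v)

module _ (S : Setting) where
  open Setting S

  Alt : Set
  Alt = (v : Fin nVars) → Fin (2 + extra v)

  value : Alt → Fin nVars → A
  value α v = val v (α v)

  elems : Subset nVars → List (Fin nVars)
  elems Y = foldr (λ v r → if Data.Vec.lookup Y v then v ∷ r else r) [] (Data.List.allFin nVars)

  -- ⊕ of a list of values (nothing for the empty list; only used on nonempty sets)
  ⨁ : List A → Maybe A
  ⨁ [] = nothing
  ⨁ (x ∷ xs) = just (foldr _⊕_ x xs)

  comb : Subset nVars → Alt → Maybe A
  comb Y α = ⨁ (Data.List.map (value α) (elems Y))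

  _>ᶜ_ : Maybe A → Maybe A → Set
  just a >ᶜ just b = b ≺ a
  _ >ᶜ _ = ⊥

  NESubset : Set
  NESubset = Σ (Subset nVars) Nonempty

  HModel : Set
  HModel = List⁺ NESubset

  layers : HModel → List NESubset
  layers π = toList π

  Yat : (π : HModel) → Fin (length (layers π)) → Subset nVars
  Yat π i = proj₁ (Data.List.lookup (layers π) i)

  _≻[_]_ : Alt → HModel → Alt → Set
  α ≻[ π ] β = ∃ λ i → (comb (Yat π i) α >ᶜ comb (Yat π i) β)
                      × (∀ j → j < i → comb (Yat π j) α ≡ comb (Yat π j) β)

  _⪰[_]_ : Alt → HModel → Alt → Set
  α ⪰[ π ] β = (∀ i → comb (Yat π i) α ≡ comb (Yat π i) β) ⊎ α ≻[ π ] β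

  data Stmt : Set where
    _≥ˢ_ : Alt → Alt → Stmt
    _>ˢ_ : Alt → Alt → Stmt

  _⊨_ : HModel → Stmt → Set
  π ⊨ (α ≥ˢ β) = α ⪰[ π ] β
  π ⊨ (α >ˢ β) = α ≻[ π ] β

  StmtSet : Set₁
  StmtSet = Stmt → Set

  _⊨ˢ_ : HModel → StmtSet → Set
  π ⊨ˢ Φ = ∀ φ → Φ φ → π ⊨ φ

  _⊫_ : StmtSet → StmtSet → Set
  Φ ⊫ Ψ = ∀ π → π ⊨ˢ Φ → π ⊨ˢ Ψ

  ⟦_⟧ : Stmt → StmtSet
  ⟦ φ ⟧ ψ = ψ ≡ φ

  Consistent : StmtSet → Set
  Consistent Φ = ∃ λ π → π ⊨ˢ Φ

  Falsifiable : StmtSet → Set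
  Falsifiable Φ = ∃ λ π → ¬ (π ⊨ˢ Φ)

  NonTrivial : StmtSet → Set
  NonTrivial Φ = Consistent Φ × Falsifiable Φ

  P3 : (n : ℕ) → (Fin n → StmtSet) → Stmt → Set
  P3 n Φ φ = ∀ i ψ → Φ i ψ → ∃ λ π → π ⊨ˢ ⟦ φ ⟧ × π ⊨ˢ ⟦ ψ ⟧

  P4 : (n : ℕ) → (Fin n → StmtSet) → Stmt → Set
  P4 n Φ φ = ∃ λ i → Φ i ⊫ ⟦ φ ⟧

module Submission where

open import Defs
open import Data.Nat using (ℕ)
open import Data.Fin using (Fin)
open import Data.Product using (_×_; _,_; map; map₁; map₂)
open import Data.Sum using (inj₂)
open import Relation.Binary.PropositionalEquality using (refl)

-- A strict preference is in particular a weak one, so {α > β} entails {α ≥ β};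
-- both (P3) and (P4) transfer along entailment between singletons.

module _ (S : Setting) where

  ≻⇒⪰ : ∀ {α β π} → _≻[_]_ S α π β → _⪰[_]_ S α π β
  ≻⇒⪰ = inj₂

  ⟦>⟧⊫⟦≥⟧ : ∀ α β → _⊫_ S (⟦_⟧ S (α >ˢ β)) (⟦_⟧ S (α ≥ˢ β))
  ⟦>⟧⊫⟦≥⟧ α β π π⊨> _ refl = ≻⇒⪰ (π⊨> _ refl)

  P3-resp-⊫ : ∀ {n Φ φ φ′} → _⊫_ S (⟦_⟧ S φ) (⟦_⟧ S φ′) → P3 S n Φ φ → P3 S n Φ φ′
  P3-resp-⊫ φ⊫φ′ p3 i ψ ψ∈Φᵢ = map₂ (map₁ (φ⊫φ′ _)) (p3 i ψ ψ∈Φᵢ)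

  P4-resp-⊫ : ∀ {n Φ φ φ′} → _⊫_ S (⟦_⟧ S φ) (⟦_⟧ S φ′) → P4 S n Φ φ → P4 S n Φ φ′
  P4-resp-⊫ φ⊫φ′ (i , Φᵢ⊫φ) = i , λ π π⊨Φᵢ → φ⊫φ′ π (Φᵢ⊫φ π π⊨Φᵢ)

corollary8 : (S : Setting) (n : ℕ) (Φ : Fin n → StmtSet S)
    → (∀ i → NonTrivial S (Φ i))
    → (α β : Alt S)
    → P3 S n Φ (α >ˢ β) × P4 S n Φ (α >ˢ β)
    → P3 S n Φ (α ≥ˢ β) × P4 S n Φ (α ≥ˢ β)
corollary8 S n Φ _ α β =
  map (P3-resp-⊫ S (⟦>⟧⊫⟦≥⟧ S α β)) (P4-resp-⊫ S (⟦>⟧⊫⟦≥⟧ S α β))
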